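{- Fix a positive integer $n$. For positive integers $m$, write $m::n$ if there exists a prime power $p^k$ (with $k \ge 0$, so $1$ counts as a prime power) such that $n \mid p^k m$. Let $$S_\le := \langle \{ m \in \mathbb{N} : m \le n,\ m::n\}\rangle, \qquad S_\ge := \langle \{ m \in \mathbb{N} : m \ge n,\ m::n\}\rangle.$$ Then $S_\le = \langle \{ m : m::n\}\rangle$, both $S_\le$ and $S_\ge$ are numerical semigroups, and $$F(S_\le) = n\left(-1 + \sum_{1 < p^k \,\|\, n} \frac{p^k - 1}{p^k}\right), \qquad F(S_\ge) = n\left(-1 + \sum_{1 < p^k \,\|\, n} \frac{2p^k - 1}{p^k}\right),$$ where the sums range over prime powers $p^k > 1$ with $p^k \,\|\, n$.
   Context: $\mathbb{N}$ denotes the nonnegative integers (here $m$ ranges over positive integers). $p^k \,\|\, n$ means $p^k \mid n$ and $p^{k+1} \nmid n$. For a set $A$ of positive integers, $\langle A\rangle$ is the submonoid of $(\mathbb{N},+)$ generated by $A$. A numerical semigroup is a submonoid $S\subseteq\mathbb{N}$ with $\mathbb{N}\setminus S$ finite; its Frobenius number $F(S)$ is the largest integer not in $S$ (with $F(\mathbb{N})=-1$). -}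

module Defs where

open import Data.Nat using (ℕ; zero; suc; _+_; _*_; _∸_; _^_; _≤_; _<_)
open import Data.Nat.DivMod using (_/_)
open import Data.Nat.Divisibility using (_∣_)
open import Data.Nat.Primality using (Prime)
open import Data.Integer as ℤ using (ℤ; +_; -[1+_])
open import Data.Product using (Σ; ∃; _×_)
open import Relation.Nullary using (¬_)
open import Relation.Binary.PropositionalEquality using (_≡_)

IsPrimePower : ℕ → Set
IsPrimePower q = Σ ℕ λ p → Σ ℕ λ k → Prime p × q ≡ p ^ k

_∷∷_ : ℕ → ℕ → Set
m ∷∷ n = Σ ℕ λ q → IsPrimePower q × n ∣ q * m

data ⟨_⟩ (A : ℕ → Set) : ℕ → Set where
  gen-zero : ⟨ A ⟩ 0
  gen-add  : ∀ {a x} → A a → ⟨ A ⟩ x → ⟨ A ⟩ (a + x)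

LeSet : ℕ → ℕ → Set
LeSet n m = 1 ≤ m × m ≤ n × m ∷∷ n

GeSet : ℕ → ℕ → Set
GeSet n m = 1 ≤ m × n ≤ m × m ∷∷ n

AllSet : ℕ → ℕ → Set
AllSet n m = 1 ≤ m × m ∷∷ n

-- S is a numerical semigroup: a submonoid of ℕ with finite complement
-- (finite complement: everything from some bound B on lies in S)
IsNumericalSemigroup : (ℕ → Set) → Set
IsNumericalSemigroup S =
  S 0 × (∀ a b → S a → S b → S (a + b)) × (Σ ℕ λ B → ∀ x → B ≤ x → S x)

-- f is the Frobenius number of S: the largest integer not in S,
-- with the convention F(ℕ) = -1.
IsFrobenius : (ℕ → Set) → ℤ → Set
IsFrobenius S f =
  (-[1+ 0 ] ℤ.≤ f) × (∀ x → f ℤ.< + x → S x) × (∀ x → + x ≡ f → ¬ S x)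

ExactPrimePower : ℕ → ℕ → Set
ExactPrimePower n q = Σ ℕ λ p → Σ ℕ λ k →
  Prime p × 1 ≤ k × q ≡ p ^ k × p ^ k ∣ n × ¬ (p ^ suc k ∣ n)

-- natural-number division, total (division by 0 gives 0; only used with q ∣ n, q > 1)
div : ℕ → ℕ → ℕ
div n zero = 0
div n (suc d) = n / suc d

-- Write N_q = n / q for the exact prime powers q ∥ n. A positive m satisfies m :: n exactly
-- when n ∣ m or N_q ∣ m for some q, so S≤ is generated by n and the N_q, and S≥ by n and the
-- N_q a with a ≥ q. Modulo q every N_r with r ≠ q vanishes while N_q is invertible, so an
-- element x = Σ N_q d_q + e n of either semigroup determines each d_q modulo q. If
-- x + n = Σ N_q g_q with g_q ≡ -1 (mod q), then also d_q ≡ -1 (mod q); for g_q = q - 1 this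
-- gives d_q ≥ g_q, and in S≥, where each d_q is 0 or at least q, it does so for g_q = 2q - 1.
-- Then x ≥ Σ N_q g_q = x + n, which is absurd. Conversely, above these bounds the Chinese
-- remainder theorem provides c_q < q with x ≡ Σ N_q c_q modulo every q, hence modulo n, and
-- x - Σ N_q c_q is then a nonnegative multiple of n (use c_q + q in place of c_q for S≥).

module Submission where

open import Defs
open import Data.Nat
open import Data.Nat.Properties
open import Data.Nat.Divisibility
open import Data.Nat.DivMod using (_/_; _%_; m*[n/m]≡n; m≡m%n+[m/n]*n; m%n<n)
open import Data.Nat.Primality
open import Data.Nat.Primality.Factorisation using (factorise)
open import Data.Nat.Coprimality as Coprimality using (Coprime; coprime-divisor; coprime-Bézout)
open import Data.Nat.GCD using (module Bézout)
open import Data.Nat.Induction using (<-wellFounded)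
open import Data.Nat.ListAction using (sum; product)
open import Data.Nat.Tactic.RingSolver using (solve-∀)
open import Algebra.Properties.CommutativeSemigroup +-commutativeSemigroup using (x∙yz≈y∙xz)
open import Data.Integer as ℤ using (ℤ; +_; -[1+_])
import Data.Integer.Properties as ℤ
open import Data.Integer.Tactic.RingSolver using () renaming (solve-∀ to ℤ-solve-∀)
open import Data.List using (List; []; _∷_; map; filter; upTo)
open import Data.List.Membership.Propositional using (_∈_)
open import Data.List.Membership.Propositional.Properties using (∈-filter⁺; ∈-filter⁻; ∈-upTo⁺)
open import Data.List.Relation.Unary.Any using (here; there)
open import Data.List.Relation.Unary.All as All using (_∷_)
open import Data.List.Relation.Unary.AllPairs using (_∷_)
open import Data.List.Relation.Unary.Unique.Propositional using (Unique)
import Data.List.Relation.Unary.Unique.Propositional.Properties as Unique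
open import Data.Product using (∃; ∃₂; _×_; _,_; proj₁; proj₂)
open import Data.Sum using (_⊎_; inj₁; inj₂)
open import Data.Empty using (⊥-elim)
open import Function.Base using (it; _∘_)
open import Function.Bundles using (_⇔_; mk⇔; Equivalence)
open import Induction.WellFounded using (Acc; acc)
open import Level using (0ℓ)
open import Relation.Nullary using (¬_; Dec; yes; no; contradiction; _×-dec_; ¬?)
open import Relation.Nullary.Decidable using (map′)
open import Relation.Unary using (Decidable)
open import Relation.Binary.Bundles using (Setoid)
open import Relation.Binary.Definitions using (tri<; tri≈; tri>)
open import Relation.Binary.PropositionalEquality
import Relation.Binary.Reasoning.Setoid as ≈-Reasoning

private variable m n p q r y : ℕ

-- Primes and prime powers

prime⇒>1 : Prime p → 1 < p
prime⇒>1 {p} pp = nonTrivial⇒n>1 p {{prime⇒nonTrivial pp}}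

^-monoʳ-∣ : ∀ p {i j} → i ≤ j → p ^ i ∣ p ^ j
^-monoʳ-∣ p z≤n = 1∣ _
^-monoʳ-∣ p (s≤s i≤j) = *-monoʳ-∣ p (^-monoʳ-∣ p i≤j)

coprime-^ : Prime p → ¬ p ∣ m → ∀ k → Coprime m (p ^ k)
coprime-^ pp p∤m zero (_ , d∣1) = ∣1⇒≡1 d∣1
coprime-^ {p} pp p∤m (suc k) {d} (d∣m , d∣p*pᵏ) =
  coprime-^ pp p∤m k (d∣m , coprime-divisor d⊥p d∣p*pᵏ)
  where
  d⊥p : Coprime d p
  d⊥p (e∣d , e∣p) with prime⇒irreducible pp e∣p
  ... | inj₁ e≡1 = e≡1
  ... | inj₂ refl = ⊥-elim (p∤m (∣-trans e∣d d∣m))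

prime∤^ : ∀ {p r} → Prime p → Prime r → p ≢ r → ∀ k → ¬ p ∣ r ^ k
prime∤^ {p} {r} pp pr p≢r k p∣rᵏ = >⇒≢ (prime⇒>1 pp) (coprime-^ pr r∤p k (∣-refl , p∣rᵏ))
  where
  r∤p : ¬ r ∣ p
  r∤p r∣p with prime⇒irreducible pp r∣p
  ... | inj₁ r≡1 = >⇒≢ (prime⇒>1 pr) r≡1
  ... | inj₂ r≡p = p≢r (sym r≡p)

coprime-∣-* : ∀ {a b} → Coprime a b → a ∣ y → b ∣ y → a * b ∣ y
coprime-∣-* {y} {a} {b} a⊥b a∣y (divides t y≡t*b) =
  subst (a * b ∣_) (sym y≡t*b) (*-monoˡ-∣ b a∣t)
  where
  a∣t : a ∣ t
  a∣t = coprime-divisor a⊥b (subst (a ∣_) (trans y≡t*b (*-comm t b)) a∣y)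

∃-prime-factor : 1 < m → ∃ λ p → Prime p × p ∣ m
∃-prime-factor {m} 1<m with factorise m {{>-nonZero (<⇒≤ 1<m)}}
... | record { factors = [] ; isFactorisation = m≡1 } = contradiction m≡1 (>⇒≢ 1<m)
... | record { factors = p ∷ ps ; isFactorisation = m≡p*ps ; factorsPrime = pp ∷ _ } =
  p , pp , divides (product ps) (trans m≡p*ps (*-comm p _))

split-prime : Prime p → ∀ m → .{{NonZero m}} → ∃₂ λ k M → m ≡ p ^ k * M × ¬ p ∣ M
split-prime {p} pp m = go m (<-wellFounded m)
  where
  go : ∀ m → Acc _<_ m → .{{NonZero m}} → ∃₂ λ k M → m ≡ p ^ k * M × ¬ p ∣ M
  go m (acc rec) with p ∣? m
  ... | no p∤m = 0 , m , sym (*-identityˡ m) , p∤m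
  ... | yes p∣m@(divides c m≡c*p)
    with go c (rec (quotient-< p∣m {{prime⇒nonTrivial pp}})) {{quotient≢0 p∣m}}
  ...   | k , M , c≡pᵏM , p∤M = suc k , M , m≡pᵏ⁺¹M , p∤M
    where
    m≡pᵏ⁺¹M : m ≡ p ^ suc k * M
    m≡pᵏ⁺¹M = begin
      m               ≡⟨ m≡c*p ⟩
      c * p           ≡⟨ cong (_* p) c≡pᵏM ⟩
      p ^ k * M * p   ≡⟨ *-comm _ p ⟩
      p * (p ^ k * M) ≡⟨ *-assoc p _ M ⟨
      p * p ^ k * M   ∎
      where open ≡-Reasoning

p∣p^ : ∀ p {j} → 0 < j → p ∣ p ^ j
p∣p^ p {suc j} _ = m∣m*n (p ^ j)

^-grows : 1 < p → ∀ k → k < p ^ k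
^-grows 1<p zero = z<s
^-grows {p} 1<p (suc k) = begin-strict
  suc k       ≤⟨ ^-grows 1<p k ⟩
  p ^ k       <⟨ m<m*n (p ^ k) p 1<p ⟩
  p ^ k * p   ≡⟨ *-comm (p ^ k) p ⟩
  p ^ suc k   ∎
  where
  open ≤-Reasoning
  instance _ = m^n≢0 p k {{>-nonZero (<-trans z<s 1<p)}}

∣-<⇒2*≤ : q ∣ m → q < m → 2 * q ≤ m
∣-<⇒2*≤ (divides zero refl) ()
∣-<⇒2*≤ {q} (divides 1 refl) q<q+0 = contradiction q<q+0 (<-irrefl (sym (+-identityʳ q)))
∣-<⇒2*≤ {q} (divides (suc (suc c)) refl) _ = +-monoʳ-≤ q (+-monoʳ-≤ q z≤n)

-- Exact prime powers

n≡q*div : q ∣ n → n ≡ q * div n q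
n≡q*div {zero} (divides c n≡c*0) = trans n≡c*0 (*-zeroʳ c)
n≡q*div {suc q} q∣n = sym (m*[n/m]≡n q∣n)

div≢0 : .{{NonZero n}} → q ∣ n → NonZero (div n q)
div≢0 {n} {q} q∣n = ≢-nonZero λ div≡0 →
  ≢-nonZero⁻¹ n (trans (n≡q*div q∣n) (trans (cong (q *_) div≡0) (*-zeroʳ q)))

exact⇒primePower : ExactPrimePower n q → IsPrimePower q
exact⇒primePower (p , k , pp , _ , q≡pᵏ , _) = p , k , pp , q≡pᵏ

exact⇒>1 : ExactPrimePower n q → 1 < q
exact⇒>1 (p , k , pp , 0<k , refl , _) = ^-monoʳ-< p (prime⇒>1 pp) 0<k

exact⇒nonZero : ExactPrimePower n q → NonZero q
exact⇒nonZero e = >-nonZero (<-trans z<s (exact⇒>1 e))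

exact⇒∣ : ExactPrimePower n q → q ∣ n
exact⇒∣ (p , k , _ , _ , refl , pᵏ∣n , _) = pᵏ∣n

exact⇒coprime-div : ExactPrimePower n q → Coprime (div n q) q
exact⇒coprime-div {n} (p , k , pp , _ , refl , pᵏ∣n , pᵏ⁺¹∤n) = coprime-^ pp p∤div k
  where
  p∤div : ¬ p ∣ div n (p ^ k)
  p∤div p∣div =
    pᵏ⁺¹∤n (subst₂ _∣_ (*-comm (p ^ k) p) (sym (n≡q*div pᵏ∣n)) (*-monoʳ-∣ (p ^ k) p∣div))

exact-distinct⇒∣div : ExactPrimePower n q → ExactPrimePower n r → q ≢ r → q ∣ div n r
exact-distinct⇒∣div (p , k , pp , _ , refl , pᵏ∣n , pᵏ⁺¹∤n)
                    (p′ , k′ , pp′ , _ , refl , p′ᵏ′∣n , p′ᵏ′⁺¹∤n) q≢r with p ≟ p′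
... | no p≢p′ = coprime-divisor (coprime-^ pp′ (prime∤^ pp′ pp (≢-sym p≢p′) k) k′)
                                (subst (p ^ k ∣_) (n≡q*div p′ᵏ′∣n) pᵏ∣n)
... | yes refl with <-cmp k k′
...   | tri< k<k′ _ _ = ⊥-elim (pᵏ⁺¹∤n (∣-trans (^-monoʳ-∣ p k<k′) p′ᵏ′∣n))
...   | tri≈ _ refl _ = ⊥-elim (q≢r refl)
...   | tri> _ _ k>k′ = ⊥-elim (p′ᵏ′⁺¹∤n (∣-trans (^-monoʳ-∣ p k>k′) pᵏ∣n))

split⇒exact : ∀ {k M} → Prime p → 0 < k → n ≡ p ^ k * M → ¬ p ∣ M → ExactPrimePower n (p ^ k)
split⇒exact {p} {n} {k} {M} pp 0<k n≡pᵏM p∤M =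
  p , k , pp , 0<k , refl , subst (p ^ k ∣_) (sym n≡pᵏM) (m∣m*n M) , pᵏ⁺¹∤n
  where
  instance _ = m^n≢0 p k {{prime⇒nonZero pp}}
  pᵏ⁺¹∤n : ¬ p ^ suc k ∣ n
  pᵏ⁺¹∤n pᵏ⁺¹∣n = p∤M (*-cancelˡ-∣ (p ^ k) (subst₂ _∣_ (*-comm p (p ^ k)) n≡pᵏM pᵏ⁺¹∣n))

exact-lift : ∀ {k M} → Prime p → m ≡ p ^ k * M → ¬ p ∣ M → ExactPrimePower M q → ExactPrimePower m q
exact-lift {p} {m} {q} {k} {M} pp m≡pᵏM p∤M (r , j , pr , 0<j , refl , rʲ∣M , rʲ⁺¹∤M) =
  r , j , pr , 0<j , refl , ∣-trans rʲ∣M (subst (M ∣_) (sym m≡pᵏM) (n∣m*n (p ^ k))) , rʲ⁺¹∤m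
  where
  r≢p : r ≢ p
  r≢p refl = p∤M (∣-trans (p∣p^ p 0<j) rʲ∣M)
  rʲ⁺¹∤m : ¬ r ^ suc j ∣ m
  rʲ⁺¹∤m rʲ⁺¹∣m = rʲ⁺¹∤M (coprime-divisor (coprime-^ pp (prime∤^ pp pr (≢-sym r≢p) (suc j)) k)
                                           (subst (r ^ suc j ∣_) m≡pᵏM rʲ⁺¹∣m))

∣-by-exactPrimePowers : ∀ m → .{{NonZero m}} → (∀ q → ExactPrimePower m q → q ∣ y) → m ∣ y
∣-by-exactPrimePowers {y} m = go m (<-wellFounded m)
  where
  go : ∀ m → Acc _<_ m → .{{NonZero m}} → (∀ q → ExactPrimePower m q → q ∣ y) → m ∣ y
  go m (acc rec) h with m ≤? 1
  ... | yes m≤1 = subst (_∣ y) (≤-antisym (>-nonZero⁻¹ m) m≤1) (1∣ y)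
  ... | no m≰1 with ∃-prime-factor (≰⇒> m≰1)
  ...   | p , pp , p∣m with split-prime pp m
  ...     | zero , M , m≡M , p∤M = ⊥-elim (p∤M (subst (p ∣_) (trans m≡M (*-identityˡ M)) p∣m))
  ...     | k@(suc _) , M , m≡pᵏM , p∤M =
    subst (_∣ y) (sym m≡pᵏM) (coprime-∣-* pᵏ⊥M (h _ (split⇒exact {k = k} pp z<s m≡pᵏM p∤M)) M∣y)
    where
    instance
      _ = m^n≢0 p k {{prime⇒nonZero pp}}
      M≢0 : NonZero M
      M≢0 = m*n≢0⇒n≢0 (p ^ k) {{subst NonZero m≡pᵏM it}}
    pᵏ⊥M : Coprime (p ^ k) M
    pᵏ⊥M = Coprimality.sym (coprime-^ pp p∤M k)
    M<m : M < m
    M<m = subst (M <_) (trans (*-comm M _) (sym m≡pᵏM))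
                (m<m*n M (p ^ k) (^-monoʳ-< p (prime⇒>1 pp) {0} {k} z<s))
    M∣y : M ∣ y
    M∣y = go M (rec M<m) (λ q e → h q (exact-lift {k = k} pp m≡pᵏM p∤M e))

∷∷-classify : .{{NonZero n}} → m ∷∷ n → n ∣ m ⊎ ∃ λ q → ExactPrimePower n q × div n q ∣ m
∷∷-classify {n} {m} (_ , (p , j , pp , refl) , n∣pʲm) with split-prime pp n
... | zero , M , n≡M , p∤M = inj₁ (subst (_∣ m) (sym (trans n≡M (*-identityˡ M))) M∣m)
  where
  M∣m : M ∣ m
  M∣m = coprime-divisor (coprime-^ pp p∤M j) (∣-trans (subst (M ∣_) (sym n≡M) (n∣m*n 1)) n∣pʲm)
... | k@(suc _) , M , n≡pᵏM , p∤M = inj₂ (p ^ k , e , subst (_∣ m) (sym div≡M) M∣m)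
  where
  instance _ = m^n≢0 p k {{prime⇒nonZero pp}}
  e : ExactPrimePower n (p ^ k)
  e = split⇒exact {k = k} pp z<s n≡pᵏM p∤M
  div≡M : div n (p ^ k) ≡ M
  div≡M = *-cancelˡ-≡ _ _ (p ^ k) (trans (sym (n≡q*div (exact⇒∣ e))) n≡pᵏM)
  M∣m : M ∣ m
  M∣m = coprime-divisor (coprime-^ pp p∤M j)
                        (∣-trans (subst (M ∣_) (sym n≡pᵏM) (n∣m*n (p ^ k))) n∣pʲm)

exact? : ∀ n → Decidable (ExactPrimePower n)
exact? n q = map′ (λ (p , _ , k , _ , e) → p , k , e) bounded
  (anyUpTo? (λ p → anyUpTo? (λ k → exactWith? p k) (suc q)) (suc q))
  where
  ExactWith : ℕ → ℕ → Set
  ExactWith p k = Prime p × 0 < k × q ≡ p ^ k × p ^ k ∣ n × ¬ p ^ suc k ∣ n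
  exactWith? : ∀ p k → Dec (ExactWith p k)
  exactWith? p k = prime? p ×-dec 0 <? k ×-dec q ≟ p ^ k ×-dec p ^ k ∣? n ×-dec ¬? (p ^ suc k ∣? n)
  bounded : ExactPrimePower n q → ∃ λ p → p < suc q × ∃ λ k → k < suc q × ExactWith p k
  bounded (p , k , pp , 0<k , refl , rest) =
    p , s≤s p≤pᵏ , k , s≤s (<⇒≤ (^-grows (prime⇒>1 pp) k)) , pp , 0<k , refl , rest
    where
    p≤pᵏ : p ≤ p ^ k
    p≤pᵏ = subst (_≤ p ^ k) (*-identityʳ p) (^-monoʳ-≤ p {{prime⇒nonZero pp}} 0<k)

exactPrimePowers : ∀ n → .{{NonZero n}} → ∃ λ L → Unique L × (∀ q → q ∈ L ⇔ ExactPrimePower n q)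
exactPrimePowers n =
  filter (exact? n) (upTo (suc n)) ,
  Unique.filter⁺ (exact? n) (Unique.upTo⁺ (suc n)) ,
  λ q → mk⇔ (λ q∈L → proj₂ (∈-filter⁻ (exact? n) {xs = upTo (suc n)} q∈L))
             (λ e → ∈-filter⁺ (exact? n) (∈-upTo⁺ (s≤s (∣⇒≤ (exact⇒∣ e)))) e)

-- Generated submonoids

module _ {A : ℕ → Set} where

  ⟨⟩-+ : ∀ {x y} → ⟨ A ⟩ x → ⟨ A ⟩ y → ⟨ A ⟩ (x + y)
  ⟨⟩-+ gen-zero y∈ = y∈
  ⟨⟩-+ {y = y} (gen-add {a} {x} a∈ x∈) y∈ =
    subst ⟨ A ⟩ (sym (+-assoc a x y)) (gen-add a∈ (⟨⟩-+ x∈ y∈))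

  ⟨⟩-* : ∀ k {x} → ⟨ A ⟩ x → ⟨ A ⟩ (k * x)
  ⟨⟩-* zero x∈ = gen-zero
  ⟨⟩-* (suc k) x∈ = ⟨⟩-+ x∈ (⟨⟩-* k x∈)

  ⟨⟩-generator : ∀ {a} → A a → ⟨ A ⟩ a
  ⟨⟩-generator {a} a∈ = subst ⟨ A ⟩ (+-identityʳ a) (gen-add a∈ gen-zero)

  ⟨⟩-sum : ∀ {B : Set} (f : B → ℕ) xs → (∀ {q} → q ∈ xs → ⟨ A ⟩ (f q)) → ⟨ A ⟩ (sum (map f xs))
  ⟨⟩-sum f [] _ = gen-zero
  ⟨⟩-sum f (q ∷ xs) f∈ = ⟨⟩-+ (f∈ (here refl)) (⟨⟩-sum f xs (f∈ ∘ there))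

  ⟨⟩-isNumericalSemigroup : ∀ B → (∀ x → B ≤ x → ⟨ A ⟩ x) → IsNumericalSemigroup ⟨ A ⟩
  ⟨⟩-isNumericalSemigroup B large∈ = gen-zero , (λ _ _ → ⟨⟩-+) , B , large∈

  ⟨⟩-one : (∀ {a} → A a → 1 ≤ a) → ⟨ A ⟩ 1 → A 1
  ⟨⟩-one positive one∈ = go one∈ refl
    where
    go : ∀ {x} → ⟨ A ⟩ x → x ≡ 1 → A 1
    go (gen-add {a} {x} a∈ _) a+x≡1 =
      subst A (≤-antisym (subst (a ≤_) a+x≡1 (m≤m+n a x)) (positive a∈)) a∈

⟨⟩-⊆ : ∀ {A B : ℕ → Set} → (∀ {a} → A a → ⟨ B ⟩ a) → ∀ {x} → ⟨ A ⟩ x → ⟨ B ⟩ x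
⟨⟩-⊆ A⊆⟨B⟩ gen-zero = gen-zero
⟨⟩-⊆ A⊆⟨B⟩ (gen-add a∈ x∈) = ⟨⟩-+ (A⊆⟨B⟩ a∈) (⟨⟩-⊆ A⊆⟨B⟩ x∈)

isFrobenius-shift : ∀ {S : ℕ → Set} n T → n ≤ suc T → (∀ x → T < x + n → S x) →
                    (∀ x → x + n ≡ T → ¬ S x) → IsFrobenius S (ℤ.- (+ n) ℤ.+ + T)
isFrobenius-shift n T n≤1+T large∈ gap∉ =
  -1≤f , (λ x f<x → large∈ x (ℤ.drop‿+<+ (subst (ℤ._< + (x + n)) f+n≡T (ℤ.+-monoˡ-< (+ n) f<x)))) ,
         (λ x x≡f → gap∉ x (ℤ.+-injective (trans (cong (ℤ._+ + n) x≡f) f+n≡T)))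
  where
  f+n≡T : (ℤ.- (+ n) ℤ.+ + T) ℤ.+ + n ≡ + T
  f+n≡T = cancel (+ n) (+ T)
    where
    cancel : ∀ a b → (ℤ.- a ℤ.+ b) ℤ.+ a ≡ b
    cancel = ℤ-solve-∀
  -1≤f : -[1+ 0 ] ℤ.≤ ℤ.- (+ n) ℤ.+ + T
  -1≤f = begin
    -[1+ 0 ]          ≡⟨ T⊖1+T≡-1 ⟨
    T ℤ.⊖ suc T       ≤⟨ ℤ.⊖-monoʳ-≥-≤ T n≤1+T ⟩
    T ℤ.⊖ n           ≡⟨ ℤ.-m+n≡n⊖m n T ⟨
    ℤ.- (+ n) ℤ.+ + T ∎
    where
    open ℤ.≤-Reasoning
    T⊖1+T≡-1 : T ℤ.⊖ suc T ≡ -[1+ 0 ]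
    T⊖1+T≡-1 = subst₂ (λ a b → a ℤ.⊖ b ≡ -[1+ 0 ]) (+-identityʳ T) (+-comm T 1) (ℤ.+-cancelˡ-⊖ T 0 1)

n∷∷n : n ∷∷ n
n∷∷n {n} = 1 , (2 , 0 , prime[2] , refl) , n∣m*n 1

div∈LeSet : .{{NonZero n}} → ExactPrimePower n q → LeSet n (div n q)
div∈LeSet {n} {q} e =
  >-nonZero⁻¹ _ {{div≢0 q∣n}} , div≤n , q , exact⇒primePower e , subst (n ∣_) (n≡q*div q∣n) ∣-refl
  where
  q∣n : q ∣ n
  q∣n = exact⇒∣ e
  div≤n : div n q ≤ n
  div≤n = subst (div n q ≤_) (sym (n≡q*div q∣n)) (m≤n*m (div n q) q {{exact⇒nonZero e}})

⟨LeSet⟩⇔⟨AllSet⟩ : .{{NonZero n}} → ∀ x → ⟨ LeSet n ⟩ x ⇔ ⟨ AllSet n ⟩ x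
⟨LeSet⟩⇔⟨AllSet⟩ {n} x = mk⇔ (⟨⟩-⊆ λ (1≤m , _ , m∷∷n) → ⟨⟩-generator (1≤m , m∷∷n)) (⟨⟩-⊆ All⊆⟨Le⟩)
  where
  All⊆⟨Le⟩ : ∀ {m} → AllSet n m → ⟨ LeSet n ⟩ m
  All⊆⟨Le⟩ (_ , m∷∷n) with ∷∷-classify m∷∷n
  ... | inj₁ (divides c m≡c*n) =
    subst ⟨ LeSet n ⟩ (sym m≡c*n) (⟨⟩-* c (⟨⟩-generator (>-nonZero⁻¹ n , ≤-refl , n∷∷n)))
  ... | inj₂ (q , e , divides c m≡c*div) =
    subst ⟨ LeSet n ⟩ (sym m≡c*div) (⟨⟩-* c (⟨⟩-generator (div∈LeSet e)))

div*≥∈GeSet : .{{NonZero n}} → ExactPrimePower n q → ∀ {a} → q ≤ a → GeSet n (div n q * a)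
div*≥∈GeSet {n} {q} e {a} q≤a =
  ≤-trans (>-nonZero⁻¹ n) n≤div*a , n≤div*a , q , exact⇒primePower e , n∣q*div*a
  where
  q∣n : q ∣ n
  q∣n = exact⇒∣ e
  n≤div*a : n ≤ div n q * a
  n≤div*a = subst (_≤ div n q * a) (trans (*-comm _ q) (sym (n≡q*div q∣n)))
                  (*-monoʳ-≤ (div n q) q≤a)
  n∣q*div*a : n ∣ q * (div n q * a)
  n∣q*div*a = subst (n ∣_) (trans (cong (_* a) (n≡q*div q∣n)) (*-assoc q _ a)) (m∣m*n a)

module _ {A : Set} {f g : A → ℕ} where

  sum-mono-∈ : ∀ xs → (∀ {q} → q ∈ xs → f q ≤ g q) → sum (map f xs) ≤ sum (map g xs)
  sum-mono-∈ [] _ = z≤n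
  sum-mono-∈ (q ∷ xs) f≤g = +-mono-≤ (f≤g (here refl)) (sum-mono-∈ xs (f≤g ∘ there))

  sum-cong-∈ : ∀ xs → (∀ {q} → q ∈ xs → f q ≡ g q) → sum (map f xs) ≡ sum (map g xs)
  sum-cong-∈ [] _ = refl
  sum-cong-∈ (q ∷ xs) f≡g = cong₂ _+_ (f≡g (here refl)) (sum-cong-∈ xs (f≡g ∘ there))

module _ {A : Set} (f : A → ℕ) where

  ∈⇒≤sum : ∀ {xs q} → q ∈ xs → f q ≤ sum (map f xs)
  ∈⇒≤sum {q ∷ xs} (here refl) = m≤m+n (f q) _
  ∈⇒≤sum {x ∷ xs} (there q∈xs) = ≤-trans (∈⇒≤sum q∈xs) (m≤n+m _ (f x))

  sum-∣ : ∀ {d} xs → (∀ {q} → q ∈ xs → d ∣ f q) → d ∣ sum (map f xs)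
  sum-∣ [] _ = _ ∣0
  sum-∣ (q ∷ xs) d∣f = ∣m∣n⇒∣m+n (d∣f (here refl)) (sum-∣ xs (d∣f ∘ there))

  sum-zero : ∀ xs → (∀ {q} → q ∈ xs → f q ≡ 0) → sum (map f xs) ≡ 0
  sum-zero [] _ = refl
  sum-zero (q ∷ xs) f≡0 = cong₂ _+_ (f≡0 (here refl)) (sum-zero xs (f≡0 ∘ there))

sum-pick : ∀ {A : Set} {xs : List A} {q} → Unique xs → q ∈ xs →
           ∃ λ ys → (∀ {y} → y ∈ ys → y ∈ xs × y ≢ q) ×
                    (∀ (f : A → ℕ) → sum (map f xs) ≡ f q + sum (map f ys))
sum-pick (q∉xs ∷ _) (here refl) =
  _ , (λ y∈ → there y∈ , λ { refl → All.lookup q∉xs y∈ refl }) , λ _ → refl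
sum-pick {xs = x ∷ xs} {q} (x∉xs ∷ xs!) (there q∈xs) with sum-pick xs! q∈xs
... | ys , ys⊆ , Σxs≡ = x ∷ ys , x∷ys⊆ , Σx∷xs≡
  where
  x∷ys⊆ : ∀ {y} → y ∈ x ∷ ys → y ∈ x ∷ xs × y ≢ q
  x∷ys⊆ (here refl) = here refl , λ { refl → All.lookup x∉xs q∈xs refl }
  x∷ys⊆ (there y∈) = there (proj₁ (ys⊆ y∈)) , proj₂ (ys⊆ y∈)
  Σx∷xs≡ : ∀ (f : _ → ℕ) → f x + sum (map f xs) ≡ f q + (f x + sum (map f ys))
  Σx∷xs≡ f = trans (cong (λ s → f x + s) (Σxs≡ f)) (x∙yz≈y∙xz (f x) (f q) _)

∈-choice : ∀ {P : ℕ → ℕ → Set} xs → (∀ {q} → q ∈ xs → ∃ (P q)) →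
           ∃ λ (c : ℕ → ℕ) → ∀ {q} → q ∈ xs → P q (c q)
∈-choice [] _ = (λ _ → 0) , λ ()
∈-choice {P} (x ∷ xs) choose with ∈-choice xs (choose ∘ there)
... | c , c-ok = c′ , c′-ok
  where
  c′ : ℕ → ℕ
  c′ q with x ≟ q
  ... | yes _ = proj₁ (choose (here refl))
  ... | no  _ = c q
  c′-ok : ∀ {q} → q ∈ x ∷ xs → P q (c′ q)
  c′-ok {q} q∈ with x ≟ q
  c′-ok (here refl) | yes refl = proj₂ (choose (here refl))
  c′-ok (there q∈)  | yes refl = proj₂ (choose (here refl))
  c′-ok (here refl) | no x≢q   = ⊥-elim (x≢q refl)
  c′-ok (there q∈)  | no _     = c-ok q∈

bump : (ℕ → ℕ) → ℕ → ℕ → ℕ → ℕ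
bump d q c q′ with q ≟ q′
... | yes _ = c + d q′
... | no  _ = d q′

bump-here : ∀ d q c → bump d q c q ≡ c + d q
bump-here d q c with q ≟ q
... | yes _ = refl
... | no q≢q = ⊥-elim (q≢q refl)

bump-elsewhere : ∀ d {q q′} c → q ≢ q′ → bump d q c q′ ≡ d q′
bump-elsewhere d {q} {q′} c q≢q′ with q ≟ q′
... | yes q≡q′ = ⊥-elim (q≢q′ q≡q′)
... | no  _ = refl

-- Congruences

infix 4 _≡_mod_
_≡_mod_ : ℕ → ℕ → ℕ → Set
x ≡ y mod q = ∃₂ λ s t → x + s * q ≡ y + t * q

module _ {q : ℕ} where

  ≡-mod-refl : ∀ {x} → x ≡ x mod q
  ≡-mod-refl = 0 , 0 , refl

  ≡-mod-sym : ∀ {x y} → x ≡ y mod q → y ≡ x mod q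
  ≡-mod-sym (s , t , eq) = t , s , sym eq

  ≡-mod-trans : ∀ {x y z} → x ≡ y mod q → y ≡ z mod q → x ≡ z mod q
  ≡-mod-trans {x} {y} {z} (s , t , x≡y) (s′ , t′ , y≡z) = s + s′ , t′ + t , (begin
    x + (s + s′) * q      ≡⟨ shuffle x s s′ q ⟩
    (x + s * q) + s′ * q  ≡⟨ cong (_+ s′ * q) x≡y ⟩
    (y + t * q) + s′ * q  ≡⟨ shuffle′ y t s′ q ⟩
    (y + s′ * q) + t * q  ≡⟨ cong (_+ t * q) y≡z ⟩
    (z + t′ * q) + t * q  ≡⟨ shuffle z t′ t q ⟨
    z + (t′ + t) * q      ∎)
    where
    open ≡-Reasoning
    shuffle : ∀ x s s′ q → x + (s + s′) * q ≡ (x + s * q) + s′ * q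
    shuffle = solve-∀
    shuffle′ : ∀ y t s′ q → (y + t * q) + s′ * q ≡ (y + s′ * q) + t * q
    shuffle′ = solve-∀

  ≡-mod-setoid : Setoid 0ℓ 0ℓ
  ≡-mod-setoid = record
    { Carrier = ℕ
    ; _≈_ = _≡_mod q
    ; isEquivalence = record { refl = ≡-mod-refl ; sym = ≡-mod-sym ; trans = ≡-mod-trans }
    }

  ≡-mod-*ˡ : ∀ k {x y} → x ≡ y mod q → k * x ≡ k * y mod q
  ≡-mod-*ˡ k {x} {y} (s , t , x≡y) = k * s , k * t , (begin
    k * x + k * s * q   ≡⟨ distrib k x s q ⟩
    k * (x + s * q)     ≡⟨ cong (k *_) x≡y ⟩
    k * (y + t * q)     ≡⟨ distrib k y t q ⟨
    k * y + k * t * q   ∎)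
    where
    open ≡-Reasoning
    distrib : ∀ k x s q → k * x + k * s * q ≡ k * (x + s * q)
    distrib = solve-∀

  ≡-mod-+ˡ : ∀ z {x y} → x ≡ y mod q → z + x ≡ z + y mod q
  ≡-mod-+ˡ z {x} {y} (s , t , x≡y) = s , t , (begin
    z + x + s * q    ≡⟨ +-assoc z x _ ⟩
    z + (x + s * q)  ≡⟨ cong (λ w → z + w) x≡y ⟩
    z + (y + t * q)  ≡⟨ +-assoc z y _ ⟨
    z + y + t * q    ∎)
    where open ≡-Reasoning

  +-multiple-≡-mod : ∀ x {y} → q ∣ y → x + y ≡ x mod q
  +-multiple-≡-mod x (divides c y≡c*q) = 0 , c , trans (+-identityʳ _) (cong (λ y → x + y) y≡c*q)

  ≡0-mod⇒∣ : ∀ {x} → x ≡ 0 mod q → q ∣ x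
  ≡0-mod⇒∣ {x} (s , t , x+sq≡tq) =
    ∣m+n∣m⇒∣n (subst (q ∣_) (trans (sym x+sq≡tq) (+-comm x (s * q))) (n∣m*n t)) (n∣m*n s)

  ≡-mod⇒∣∸ : ∀ {x y} → x ≡ y mod q → q ∣ x ∸ y
  ≡-mod⇒∣∸ {x} {y} (s , t , x≡y) with ≤-total y x
  ... | inj₂ x≤y = subst (q ∣_) (sym (m≤n⇒m∸n≡0 x≤y)) (q ∣0)
  ... | inj₁ y≤x = ≡0-mod⇒∣ (s , t , +-cancelˡ-≡ y _ _ (begin
    y + ((x ∸ y) + s * q)   ≡⟨ +-assoc y _ _ ⟨
    (y + (x ∸ y)) + s * q   ≡⟨ cong (_+ s * q) (m+[n∸m]≡n y≤x) ⟩
    x + s * q               ≡⟨ x≡y ⟩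
    y + t * q               ∎))
    where open ≡-Reasoning

  %-≡-mod : .{{_ : NonZero q}} → ∀ x → x ≡ x % q mod q
  %-≡-mod x = 0 , x / q , trans (+-identityʳ x) (m≡m%n+[m/n]*n x q)

coprime⇒invertible : ∀ {a q} → Coprime a q → .{{NonZero q}} → ∃ λ w → a * w ≡ 1 mod q
coprime⇒invertible {a} {q} a⊥q with coprime-Bézout a⊥q
... | Bézout.+- x y 1+yq≡xa =
  x , 0 , y , trans (+-identityʳ (a * x)) (trans (*-comm a x) (sym 1+yq≡xa))
-- In the second case x a ≡ -1, so the inverse is x (q - 1).
... | Bézout.-+ x y 1+xa≡yq with q
...   | suc q-1 = x * q-1 , 1 , y * q-1 , (begin
  a * (x * q-1) + 1 * suc q-1   ≡⟨ expand a x q-1 ⟩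
  1 + (1 + x * a) * q-1         ≡⟨ cong (λ z → 1 + z * q-1) 1+xa≡yq ⟩
  1 + y * suc q-1 * q-1         ≡⟨ regroup y q-1 ⟩
  1 + y * q-1 * suc q-1         ∎)
  where
  open ≡-Reasoning
  expand : ∀ a x q-1 → a * (x * q-1) + 1 * suc q-1 ≡ 1 + (1 + x * a) * q-1
  expand = solve-∀
  regroup : ∀ y q-1 → 1 + y * suc q-1 * q-1 ≡ 1 + y * q-1 * suc q-1
  regroup = solve-∀

coprime⇒solvable : ∀ {a q} → Coprime a q → .{{_ : NonZero q}} →
                   ∀ x → ∃ λ c → c < q × x ≡ a * c mod q
coprime⇒solvable {a} {q} a⊥q x with coprime⇒invertible a⊥q
... | w , aw≡1 = (x * w) % q , m%n<n (x * w) q , (begin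
  x                 ≡⟨ *-identityʳ x ⟨
  x * 1             ≈⟨ ≡-mod-*ˡ x (≡-mod-sym aw≡1) ⟩
  x * (a * w)       ≡⟨ swap x a w ⟩
  a * (x * w)       ≈⟨ ≡-mod-*ˡ a (%-≡-mod (x * w)) ⟩
  a * ((x * w) % q) ∎)
  where
  open ≈-Reasoning (≡-mod-setoid {q})
  swap : ∀ x a w → x * (a * w) ≡ a * (x * w)
  swap = solve-∀

-- The Frobenius numbers

module Frobenius (n : ℕ) .{{_ : NonZero n}} (L : List ℕ) (L! : Unique L)
                 (L⇔exact : ∀ q → q ∈ L ⇔ ExactPrimePower n q) where

  ∈⇒exact : q ∈ L → ExactPrimePower n q
  ∈⇒exact {q} = Equivalence.to (L⇔exact q)

  exact⇒∈ : ExactPrimePower n q → q ∈ L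
  exact⇒∈ {q} = Equivalence.from (L⇔exact q)

  cofactorSum : (ℕ → ℕ) → ℕ
  cofactorSum f = sum (map (λ q → div n q * f q) L)

  cofactorSum-≡-mod : q ∈ L → ∀ f → cofactorSum f ≡ div n q * f q mod q
  cofactorSum-≡-mod {q} q∈L f with sum-pick L! q∈L
  ... | ys , ys⊆ , Σ≡ = begin
    cofactorSum f                                       ≡⟨ Σ≡ _ ⟩
    div n q * f q + sum (map (λ y → div n y * f y) ys)
      ≈⟨ +-multiple-≡-mod _ (sum-∣ _ ys q∣term) ⟩
    div n q * f q                                       ∎
    where
    open ≈-Reasoning (≡-mod-setoid {q})
    q∣term : ∀ {y} → y ∈ ys → q ∣ div n y * f y
    q∣term y∈ys with ys⊆ y∈ys
    ... | y∈L , y≢q = ∣m⇒∣m*n (f _) (exact-distinct⇒∣div (∈⇒exact q∈L) (∈⇒exact y∈L) (≢-sym y≢q))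

  cofactorSum-bump : q ∈ L → ∀ d c → cofactorSum (bump d q c) ≡ div n q * c + cofactorSum d
  cofactorSum-bump {q} q∈L d c with sum-pick L! q∈L
  ... | ys , ys⊆ , Σ≡ = begin
    cofactorSum (bump d q c)                                  ≡⟨ Σ≡ _ ⟩
    N * bump d q c q + sum (map (λ y → div n y * bump d q c y) ys)
      ≡⟨ cong₂ (λ a s → N * a + s) (bump-here d q c) (sum-cong-∈ ys elsewhere) ⟩
    N * (c + d q) + S                ≡⟨ cong (_+ S) (*-distribˡ-+ N c (d q)) ⟩
    N * c + N * d q + S              ≡⟨ +-assoc (N * c) _ _ ⟩
    N * c + (N * d q + S)            ≡⟨ cong (λ s → N * c + s) (Σ≡ _) ⟨
    N * c + cofactorSum d            ∎
    where
    open ≡-Reasoning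
    N : ℕ
    N = div n q
    S : ℕ
    S = sum (map (λ y → div n y * d y) ys)
    elsewhere : ∀ {y} → y ∈ ys → div n y * bump d q c y ≡ div n y * d y
    elsewhere {y} y∈ys = cong (div n y *_) (bump-elsewhere d c (≢-sym (proj₂ (ys⊆ y∈ys))))

  record Decomposition (b x : ℕ) : Set where
    field
      coeff  : ℕ → ℕ
      nCoeff : ℕ
      x≡     : x ≡ cofactorSum coeff + nCoeff * n
      large  : ∀ {q} → q ∈ L → coeff q ≡ 0 ⊎ b ≤ div n q * coeff q

  decompose : ∀ {A b} → (∀ {a} → A a → b ≤ a × a ∷∷ n) → ∀ {x} → ⟨ A ⟩ x → Decomposition b x
  decompose gens gen-zero = record
    { coeff  = λ _ → 0
    ; nCoeff = 0
    ; x≡     = sym (trans (+-identityʳ _) (sum-zero _ L (λ {q} _ → *-zeroʳ (div n q))))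
    ; large  = λ _ → inj₁ refl
    }
  decompose {b = b} gens (gen-add {a} {x} a∈ x∈)
    with decompose gens x∈ | ∷∷-classify (proj₂ (gens a∈))
  ... | D | inj₁ (divides c a≡c*n) = record
    { coeff  = coeff
    ; nCoeff = c + nCoeff
    ; x≡     = trans (cong₂ _+_ a≡c*n x≡) (regroup c n (cofactorSum coeff) nCoeff)
    ; large  = large
    }
    where
    open Decomposition D
    regroup : ∀ c n s e → c * n + (s + e * n) ≡ s + (c + e) * n
    regroup = solve-∀
  ... | D | inj₂ (q , e , divides c a≡c*div) = record
    { coeff  = bump coeff q c
    ; nCoeff = nCoeff
    ; x≡     = a+x≡
    ; large  = large′
    }
    where
    open Decomposition D
    regroup : ∀ c N s en → c * N + (s + en) ≡ (N * c + s) + en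
    regroup = solve-∀
    a+x≡ : a + x ≡ cofactorSum (bump coeff q c) + nCoeff * n
    a+x≡ = begin
      a + x                                          ≡⟨ cong₂ _+_ a≡c*div x≡ ⟩
      c * div n q + (cofactorSum coeff + nCoeff * n) ≡⟨ regroup c (div n q) _ _ ⟩
      (div n q * c + cofactorSum coeff) + nCoeff * n
        ≡⟨ cong (_+ nCoeff * n) (cofactorSum-bump (exact⇒∈ e) coeff c) ⟨
      cofactorSum (bump coeff q c) + nCoeff * n      ∎
      where open ≡-Reasoning
    large′ : ∀ {q′} → q′ ∈ L → bump coeff q c q′ ≡ 0 ⊎ b ≤ div n q′ * bump coeff q c q′
    large′ {q′} q′∈L with q ≟ q′
    ... | no _ = large q′∈L
    ... | yes refl = inj₂ (≤-trans (proj₁ (gens a∈)) (begin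
      a                         ≡⟨ a≡c*div ⟩
      c * div n q               ≡⟨ *-comm c _ ⟩
      div n q * c               ≤⟨ *-monoʳ-≤ (div n q) (m≤m+n c (coeff q)) ⟩
      div n q * (c + coeff q)   ∎))
      where open ≤-Reasoning

  coeff≡-1-mod : ∀ {b x g} (D : Decomposition b x) → x + n ≡ cofactorSum g →
                          q ∈ L → q ∣ suc (g q) → q ∣ suc (Decomposition.coeff D q)
  coeff≡-1-mod {q} {x = x} {g} D x+n≡ q∈L q∣1+g =
    coprime-divisor (Coprimality.sym (exact⇒coprime-div e)) (≡0-mod⇒∣ (begin
      N * suc (d q)                   ≡⟨ *-suc N (d q) ⟩
      N + N * d q                     ≈⟨ ≡-mod-+ˡ N (≡-mod-sym (cofactorSum-≡-mod q∈L d)) ⟩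
      N + cofactorSum d               ≈⟨ ≡-mod-+ˡ N (≡-mod-sym (+-multiple-≡-mod _ (∣n⇒∣m*n nCoeff q∣n))) ⟩
      N + (cofactorSum d + nCoeff * n) ≡⟨ cong (λ s → N + s) x≡ ⟨
      N + x                           ≈⟨ ≡-mod-sym (+-multiple-≡-mod (N + x) q∣n) ⟩
      N + x + n                       ≡⟨ +-assoc N x n ⟩
      N + (x + n)                     ≡⟨ cong (λ s → N + s) x+n≡ ⟩
      N + cofactorSum g               ≈⟨ ≡-mod-+ˡ N (cofactorSum-≡-mod q∈L g) ⟩
      N + N * g q                     ≡⟨ *-suc N (g q) ⟨
      N * suc (g q)                   ≈⟨ +-multiple-≡-mod 0 (∣n⇒∣m*n N q∣1+g) ⟩
      0                               ∎))
    where
    open Decomposition D renaming (coeff to d)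
    open ≈-Reasoning (≡-mod-setoid {q})
    e : ExactPrimePower n q
    e = ∈⇒exact q∈L
    q∣n : q ∣ n
    q∣n = exact⇒∣ e
    N : ℕ
    N = div n q

  ∉⟨⟩-by-residues : ∀ {A b} → (∀ {a} → A a → b ≤ a × a ∷∷ n) → (g : ℕ → ℕ) →
         (∀ {q} → q ∈ L → q ∣ suc (g q)) →
         (∀ {q d} → q ∈ L → q ∣ suc d → d ≡ 0 ⊎ b ≤ div n q * d → g q ≤ d) →
         ∀ {x} → x + n ≡ cofactorSum g → ¬ ⟨ A ⟩ x
  ∉⟨⟩-by-residues {b = b} gens g q∣1+g g≤ {x} x+n≡ x∈ = <-irrefl refl (begin-strict
    x                               <⟨ m<m+n x (>-nonZero⁻¹ n) ⟩
    x + n                           ≡⟨ x+n≡ ⟩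
    cofactorSum g                   ≤⟨ sum-mono-∈ L (λ {q} q∈L → *-monoʳ-≤ (div n q) (g≤d q∈L)) ⟩
    cofactorSum coeff               ≤⟨ m≤m+n _ _ ⟩
    cofactorSum coeff + nCoeff * n  ≡⟨ x≡ ⟨
    x                               ∎)
    where
    D : Decomposition b x
    D = decompose gens x∈
    open Decomposition D
    open ≤-Reasoning
    g≤d : q ∈ L → g q ≤ coeff q
    g≤d q∈L = g≤ q∈L (coeff≡-1-mod D x+n≡ q∈L (q∣1+g q∈L)) (large q∈L)

  ∈⟨⟩-by-residues : ∀ {A x} → A n → (a : ℕ → ℕ) → (∀ {q} → q ∈ L → ⟨ A ⟩ (div n q * a q)) →
                    (∀ {q} → q ∈ L → x ≡ div n q * a q mod q) → cofactorSum a < x + n → ⟨ A ⟩ x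
  ∈⟨⟩-by-residues {A} {x} n∈A a terms∈ x≡a Σa<x+n =
    subst ⟨ A ⟩ x≡s+tn (⟨⟩-+ (⟨⟩-sum _ L terms∈) (⟨⟩-* (quotient n∣x∸s) (⟨⟩-generator n∈A)))
    where
    s : ℕ
    s = cofactorSum a
    x≡s : ∀ {q} → ExactPrimePower n q → x ≡ s mod q
    x≡s e = ≡-mod-trans (x≡a (exact⇒∈ e)) (≡-mod-sym (cofactorSum-≡-mod (exact⇒∈ e) a))
    n∣x∸s : n ∣ x ∸ s
    n∣x∸s = ∣-by-exactPrimePowers n (λ _ e → ≡-mod⇒∣∸ (x≡s e))
    n∣s∸x : n ∣ s ∸ x
    n∣s∸x = ∣-by-exactPrimePowers n (λ _ e → ≡-mod⇒∣∸ (≡-mod-sym (x≡s e)))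
    s≤x : s ≤ x
    s≤x with s ≤? x
    ... | yes s≤x = s≤x
    ... | no s≰x = contradiction n∣s∸x (>⇒∤ {{>-nonZero (m<n⇒0<n∸m x<s)}} s∸x<n)
      where
      x<s : x < s
      x<s = ≰⇒> s≰x
      s∸x<n : s ∸ x < n
      s∸x<n = subst (s ∸ x <_) (m+n∸m≡n x n) (∸-monoˡ-< Σa<x+n (<⇒≤ x<s))
    x≡s+tn : s + quotient n∣x∸s * n ≡ x
    x≡s+tn = trans (cong (λ z → s + z) (sym (_∣_.equality n∣x∸s))) (m+[n∸m]≡n s≤x)

  Residues : ℕ → Set
  Residues x = ∃ λ (c : ℕ → ℕ) → ∀ {q} → q ∈ L → c q < q × x ≡ div n q * c q mod q

  opaque
    residues : ∀ x → Residues x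
    residues x = ∈-choice L λ q∈L →
      let e = ∈⇒exact q∈L in coprime⇒solvable (exact⇒coprime-div e) {{exact⇒nonZero e}} x

  F≤+n F≥+n : ℕ
  F≤+n = cofactorSum (λ q → q ∸ 1)
  F≥+n = cofactorSum (λ q → 2 * q ∸ 1)

  member-≤ : ∀ x → F≤+n < x + n → ⟨ LeSet n ⟩ x
  member-≤ x F<x+n with residues x
  ... | c , c-ok = ∈⟨⟩-by-residues (>-nonZero⁻¹ n , ≤-refl , n∷∷n) c div*c∈ (proj₂ ∘ c-ok)
    (≤-<-trans (sum-mono-∈ L (λ {q} q∈L → *-monoʳ-≤ (div n q) (∸-monoˡ-≤ 1 (proj₁ (c-ok q∈L))))) F<x+n)
    where
    div*c∈ : ∀ {q} → q ∈ L → ⟨ LeSet n ⟩ (div n q * c q)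
    div*c∈ {q} q∈L =
      subst ⟨ LeSet n ⟩ (*-comm (c q) _) (⟨⟩-* (c q) (⟨⟩-generator (div∈LeSet (∈⇒exact q∈L))))

  member-≥ : ∀ x → F≥+n < x + n → ⟨ GeSet n ⟩ x
  member-≥ x F<x+n with residues x
  ... | c , c-ok = ∈⟨⟩-by-residues (>-nonZero⁻¹ n , ≤-refl , n∷∷n) a div*a∈ x≡div*a
    (≤-<-trans (sum-mono-∈ L (λ {q} q∈L → *-monoʳ-≤ (div n q) (a≤2q∸1 q∈L))) F<x+n)
    where
    a : ℕ → ℕ
    a q = c q + q
    div*a∈ : ∀ {q} → q ∈ L → ⟨ GeSet n ⟩ (div n q * a q)
    div*a∈ {q} q∈L = ⟨⟩-generator (div*≥∈GeSet (∈⇒exact q∈L) (m≤n+m q (c q)))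
    x≡div*a : ∀ {q} → q ∈ L → x ≡ div n q * a q mod q
    x≡div*a {q} q∈L = begin
      x                           ≈⟨ proj₂ (c-ok q∈L) ⟩
      div n q * c q               ≈⟨ ≡-mod-sym (+-multiple-≡-mod _ (n∣m*n (div n q))) ⟩
      div n q * c q + div n q * q ≡⟨ *-distribˡ-+ (div n q) (c q) q ⟨
      div n q * (c q + q)         ∎
      where open ≈-Reasoning (≡-mod-setoid {q})
    a≤2q∸1 : ∀ {q} → q ∈ L → a q ≤ 2 * q ∸ 1
    a≤2q∸1 {q} q∈L = ∸-monoˡ-≤ 1 (subst (suc (a q) ≤_) (cong (λ z → q + z) (sym (+-identityʳ q)))
                                    (+-monoˡ-≤ q (proj₁ (c-ok q∈L))))

  nonmember-≤ : ∀ {x} → x + n ≡ F≤+n → ¬ ⟨ LeSet n ⟩ x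
  nonmember-≤ = ∉⟨⟩-by-residues (λ (_ , _ , a∷∷n) → z≤n , a∷∷n) (λ q → q ∸ 1) q∣q
                  (λ _ q∣1+d _ → ∸-monoˡ-≤ 1 (∣⇒≤ q∣1+d))
    where
    q∣q : ∀ {q} → q ∈ L → q ∣ suc (q ∸ 1)
    q∣q {q} q∈L = subst (q ∣_) (sym (m+[n∸m]≡n (<⇒≤ (exact⇒>1 (∈⇒exact q∈L))))) ∣-refl

  nonmember-≥ : ∀ {x} → x + n ≡ F≥+n → ¬ ⟨ GeSet n ⟩ x
  nonmember-≥ = ∉⟨⟩-by-residues (λ (_ , n≤a , a∷∷n) → n≤a , a∷∷n) (λ q → 2 * q ∸ 1) q∣2q 2q∸1≤
    where
    q∣2q : ∀ {q} → q ∈ L → q ∣ suc (2 * q ∸ 1)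
    q∣2q {q} q∈L =
      subst (q ∣_) (sym (m+[n∸m]≡n (≤-trans (<⇒≤ (exact⇒>1 (∈⇒exact q∈L))) (m≤m+n q _)))) (n∣m*n 2)
    2q∸1≤ : ∀ {q d} → q ∈ L → q ∣ suc d → d ≡ 0 ⊎ n ≤ div n q * d → 2 * q ∸ 1 ≤ d
    2q∸1≤ q∈L q∣1 (inj₁ refl) = contradiction (∣1⇒≡1 q∣1) (>⇒≢ (exact⇒>1 (∈⇒exact q∈L)))
    2q∸1≤ {q} {d} q∈L q∣1+d (inj₂ n≤div*d) = ∸-monoˡ-≤ 1 (∣-<⇒2*≤ q∣1+d (s≤s q≤d))
      where
      q∣n : q ∣ n
      q∣n = exact⇒∣ (∈⇒exact q∈L)
      q≤d : q ≤ d
      q≤d = *-cancelˡ-≤ (div n q) {{div≢0 q∣n}}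
              (subst (_≤ div n q * d) (trans (n≡q*div q∣n) (*-comm q _)) n≤div*d)

  -- If F≤+n + 1 < n, then 1 ∈ S≤, which forces n to be a prime power q with F≤+n ≥ q - 1.
  n≤1+F≤+n : n ≤ suc F≤+n
  n≤1+F≤+n with n ≤? suc F≤+n
  ... | yes n≤1+F = n≤1+F
  ... | no n≰1+F = contradiction (1∈⇒n≤1+F (⟨⟩-one proj₁ (member-≤ 1 F<1+n))) n≰1+F
    where
    F<1+n : F≤+n < 1 + n
    F<1+n = m<n⇒m<1+n (<-trans (n<1+n _) (≰⇒> n≰1+F))
    1∈⇒n≤1+F : LeSet n 1 → n ≤ suc F≤+n
    1∈⇒n≤1+F (_ , _ , 1∷∷n) with ∷∷-classify 1∷∷n
    ... | inj₁ n∣1 = ≤-trans (≤-reflexive (∣1⇒≡1 n∣1)) (s≤s z≤n)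
    ... | inj₂ (q , e , div∣1) = subst (_≤ suc F≤+n) (sym n≡q) (≤-trans (m≤n+m∸n q 1) (s≤s q∸1≤F))
      where
      div≡1 : div n q ≡ 1
      div≡1 = ∣1⇒≡1 div∣1
      n≡q : n ≡ q
      n≡q = trans (n≡q*div (exact⇒∣ e)) (trans (cong (q *_) div≡1) (*-identityʳ q))
      q∸1≤F : q ∸ 1 ≤ F≤+n
      q∸1≤F = subst (_≤ F≤+n) (trans (cong (_* (q ∸ 1)) div≡1) (*-identityˡ _))
                (∈⇒≤sum (λ q → div n q * (q ∸ 1)) (exact⇒∈ e))

  F≤+n≤F≥+n : F≤+n ≤ F≥+n
  F≤+n≤F≥+n = sum-mono-∈ L (λ {q} _ → *-monoʳ-≤ (div n q) (∸-monoˡ-≤ 1 (m≤m+n q _)))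

  frobenius-≤ : IsFrobenius ⟨ LeSet n ⟩ (ℤ.- (+ n) ℤ.+ + F≤+n)
  frobenius-≤ = isFrobenius-shift n F≤+n n≤1+F≤+n member-≤ (λ _ → nonmember-≤)

  frobenius-≥ : IsFrobenius ⟨ GeSet n ⟩ (ℤ.- (+ n) ℤ.+ + F≥+n)
  frobenius-≥ =
    isFrobenius-shift n F≥+n (≤-trans n≤1+F≤+n (s≤s F≤+n≤F≥+n)) member-≥ (λ _ → nonmember-≥)

  numerical-≤ : IsNumericalSemigroup ⟨ LeSet n ⟩
  numerical-≤ =
    ⟨⟩-isNumericalSemigroup F≤+n λ x F≤x → member-≤ x (≤-<-trans F≤x (m<m+n x (>-nonZero⁻¹ n)))

  numerical-≥ : IsNumericalSemigroup ⟨ GeSet n ⟩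
  numerical-≥ =
    ⟨⟩-isNumericalSemigroup F≥+n λ x F≤x → member-≥ x (≤-<-trans F≤x (m<m+n x (>-nonZero⁻¹ n)))

theorem1p5 : (n : ℕ) → 1 ≤ n →
    (∀ x → ⟨ LeSet n ⟩ x ⇔ ⟨ AllSet n ⟩ x)
    × IsNumericalSemigroup ⟨ LeSet n ⟩
    × IsNumericalSemigroup ⟨ GeSet n ⟩
    × ((L : List ℕ) → Unique L → (∀ q → q ∈ L ⇔ ExactPrimePower n q) →
        IsFrobenius ⟨ LeSet n ⟩
          (ℤ.- (+ n) ℤ.+ + sum (map (λ q → div n q * (q ∸ 1)) L))
        × IsFrobenius ⟨ GeSet n ⟩
          (ℤ.- (+ n) ℤ.+ + sum (map (λ q → div n q * (2 * q ∸ 1)) L)))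
theorem1p5 n 1≤n =
  ⟨LeSet⟩⇔⟨AllSet⟩ , numerical-≤ , numerical-≥ ,
  λ L L! L⇔exact → let open Frobenius n L L! L⇔exact in frobenius-≤ , frobenius-≥
  where
  instance _ = >-nonZero 1≤n
  L₀ : ∃ λ L → Unique L × (∀ q → q ∈ L ⇔ ExactPrimePower n q)
  L₀ = exactPrimePowers n
  open Frobenius n (proj₁ L₀) (proj₁ (proj₂ L₀)) (proj₂ (proj₂ L₀)) using (numerical-≤; numerical-≥)
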